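{- Let $M$ be an $n$-semi-MPG or an $(n_1,n_2,\ldots,n_k)$-semi-MPG with $n,n_i\ge 3$. (a) If $M$ has an R-tiling, then the number of black edges along $\Omega(M)$ is even (the remaining edges along $\Omega(M)$ are red). (a') The statement in (a) remains true when two outer facets of $M$ are allowed to share edges, where along $\Omega(M)$ each such shared edge is counted with multiplicity 2 (so $|\Omega(M)|=\sum_{i=1}^k n_i$), and where a shared edge, belonging to no triangular face, may be colored red or black freely. (b) If $M$ has an RGB-tiling, then the numbers of red, green and blue edges along $\Omega(M)$ are either all even or all odd; precisely, they are all even when $|\Omega(M)|$ is even and all odd when $|\Omega(M)|$ is odd.
   Context: A semi-MPG is a connected simple plane graph in which every face is a triangle except some designated faces called outer facets, which form the border of the graph; an outer facet that is an $m$-sided polygon is an $m$-gon. An $(n_1,\ldots,n_k)$-semi-MPG has exactly $k$ outer facets, of sizes $n_1,\ldots,n_k$; an $n$-semi-MPG has a single outer facet, of size $n$. Here 3-gon outer facets are allowed, and (except in (a')) no two outer facets share an edge, so every edge lies in one or two triangular (non-outer) faces. $\Omega(M)$ denotes the collection of edges along the outer facets of $M$, and $|\Omega(M)|$ its size. An R-tiling of $M$ is a map $T_r:E(M)\to\{\text{red},\text{black}\}$ such that every triangular face that is not an outer facet has exactly one red edge and two black edges. An RGB-tiling is a map $T_{rgb}:E(M)\to\{\text{red},\text{green},\text{blue}\}$ such that every triangular face that is not an outer facet has its three edges colored with three different colors. -}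

module Defs where

open import Data.Nat using (ℕ; zero; suc; _+_; _≤ᵇ_)
open import Data.Nat.Divisibility using (_∣_)
open import Data.Fin using (Fin; toℕ; fromℕ<)
import Data.Fin as F
open import Data.Bool using (Bool; true; false; _∧_; if_then_else_)
open import Data.Product using (_×_; ∃)
open import Data.Sum using (_⊎_)
open import Relation.Nullary using (¬_)
open import Relation.Binary.PropositionalEquality using (_≡_; _≢_)

iter : {A : Set} → (A → A) → ℕ → A → A
iter f zero    x = x
iter f (suc k) x = f (iter f k x)

sumFin : (d : ℕ) → (Fin d → ℕ) → ℕ
sumFin zero    g = 0
sumFin (suc d) g = g F.zero + sumFin d (λ i → g (F.suc i))

countFin : (d : ℕ) → (Fin d → Bool) → ℕ
countFin d p = sumFin d (λ i → if p i then 1 else 0)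

allBelow : ℕ → (ℕ → Bool) → Bool
allBelow zero    p = true
allBelow (suc n) p = allBelow n p ∧ p n

SameOrbit : {d : ℕ} → (Fin d → Fin d) → Fin d → Fin d → Set
SameOrbit f x y = ∃ λ k → iter f k x ≡ y

-- x is the least element (in the order of Fin d) of its f-orbit;
-- for a permutation f of Fin d the orbit of x is {f^k x | k < d}.
isOrbitRep : {d : ℕ} → (Fin d → Fin d) → Fin d → Bool
isOrbitRep {d} f x = allBelow d (λ k → toℕ x ≤ᵇ toℕ (iter f k x))

numOrbits : (d : ℕ) → (Fin d → Fin d) → ℕ
numOrbits d f = countFin d (isOrbitRep f)

-- Plane graphs as combinatorial maps (rotation systems) on the set of
-- darts (half-edges) Fin d:
--   α : the fixed-point-free involution pairing the two darts of an edge
--       (edges = α-orbits),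
--   σ : the rotation around vertices, a permutation (vertices = σ-orbits;
--       the vertex of a dart is its tail),
--   φ = σ ∘ α : the face permutation (faces = φ-orbits; consecutive darts
--       x, φ x of a face boundary have as tails consecutive boundary vertices),
--   outer : designates which faces are outer facets (must be constant on
--       faces).

record BorderedMap (d : ℕ) : Set where
  field
    α        : Fin d → Fin d
    σ        : Fin d → Fin d
    σ⁻¹      : Fin d → Fin d
    α-invol  : ∀ x → α (α x) ≡ x
    α-nofix  : ∀ x → α x ≢ x
    σσ⁻¹     : ∀ x → σ (σ⁻¹ x) ≡ x
    σ⁻¹σ     : ∀ x → σ⁻¹ (σ x) ≡ x
    outer    : Fin d → Bool

  φ : Fin d → Fin d
  φ x = σ (α x)

  SameVertex : Fin d → Fin d → Set
  SameVertex = SameOrbit σ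

  #V #E #F : ℕ
  #V = numOrbits d σ
  #E = numOrbits d α
  #F = numOrbits d φ

data Conn {d : ℕ} (M : BorderedMap d) : Fin d → Fin d → Set where
  here   : ∀ {x} → Conn M x x
  stepα  : ∀ {x y} → Conn M (BorderedMap.α M x) y → Conn M x y
  stepσ  : ∀ {x y} → Conn M (BorderedMap.σ M x) y → Conn M x y

-- Semi-MPG in which two outer facets are allowed to share edges
-- (the setting of (a')).
record IsSemiMPGShared {d : ℕ} (M : BorderedMap d) : Set where
  open BorderedMap M
  field
    -- connected plane graph: connected map of genus 0 (Euler's formula)
    connected     : ∀ x y → Conn M x y
    euler         : #V + #F ≡ #E + 2
    noLoop        : ∀ x → ¬ SameVertex x (α x)
    noMulti       : ∀ x y → SameVertex x y → SameVertex (α x) (α y) → x ≡ y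
    outer-face    : ∀ x → outer (φ x) ≡ outer x
    hasOuter      : ∃ λ x → outer x ≡ true
    inner-tri     : ∀ x → outer x ≡ false →
                      (iter φ 3 x ≡ x) × (φ x ≢ x)
    -- every outer facet is an m-gon (a polygon) with m ≥ 3
    outer-polygon : ∀ x → outer x ≡ true →
                      (φ x ≢ x × φ (φ x) ≢ x) ×
                      (∀ j k → SameVertex (iter φ j x) (iter φ k x) →
                               iter φ j x ≡ iter φ k x)

-- Semi-MPG (standard): moreover no two outer facets share an edge.
IsSemiMPG : {d : ℕ} → BorderedMap d → Set
IsSemiMPG {d} M =
  IsSemiMPGShared M ×
  (∀ (x : Fin d) → outer x ≡ true → outer (α x) ≡ false)
  where open BorderedMap M

-- Colours and tilings. An edge colouring is a colouring of darts that is
-- invariant under α (i.e. a map on E(M)).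

data Col2 : Set where
  red black : Col2

data Col3 : Set where
  red green blue : Col3

_==₂_ : Col2 → Col2 → Bool
red   ==₂ red   = true
black ==₂ black = true
_     ==₂ _     = false

_==₃_ : Col3 → Col3 → Bool
red   ==₃ red   = true
green ==₃ green = true
blue  ==₃ blue  = true
_     ==₃ _     = false

isRed : Col2 → ℕ
isRed red   = 1
isRed black = 0

IsRTiling : {d : ℕ} → (M : BorderedMap d) → (Fin d → Col2) → Set
IsRTiling {d} M c =
  (∀ x → c (α x) ≡ c x) ×
  (∀ x → outer x ≡ false →
     isRed (c x) + isRed (c (φ x)) + isRed (c (φ (φ x))) ≡ 1)
  where open BorderedMap M

IsRGBTiling : {d : ℕ} → (M : BorderedMap d) → (Fin d → Col3) → Set
IsRGBTiling {d} M c =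
  (∀ x → c (α x) ≡ c x) ×
  (∀ x → outer x ≡ false →
     (c x ≢ c (φ x)) × (c (φ x) ≢ c (φ (φ x))) × (c x ≢ c (φ (φ x))))
  where open BorderedMap M

-- |Ω(M)|: edges along the outer facets, each counted once per outer facet
-- it borders (= number of darts lying in outer facets).
|Ω| : {d : ℕ} → BorderedMap d → ℕ
|Ω| {d} M = countFin d (BorderedMap.outer M)

Ωcount₂ : {d : ℕ} → (M : BorderedMap d) → (Fin d → Col2) → Col2 → ℕ
Ωcount₂ {d} M c κ = countFin d (λ x → BorderedMap.outer M x ∧ (c x ==₂ κ))

Ωcount₃ : {d : ℕ} → (M : BorderedMap d) → (Fin d → Col3) → Col3 → ℕ
Ωcount₃ {d} M c κ = countFin d (λ x → BorderedMap.outer M x ∧ (c x ==₃ κ))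

{-# OPTIONS --safe #-}
module Submission where

-- Mark the darts of the colour class that every inner triangle meets exactly
-- once (red for an R-tiling, any one colour κ for an RGB-tiling). Unmarked
-- darts are paired in two ways: the two darts of an edge, and the two unmarked
-- darts of an inner triangle. So both the unmarked darts and the unmarked inner
-- darts are even in number, and by difference so are the unmarked darts along
-- Ω(M). For an RGB-tiling this says each colour count along Ω(M) has the
-- parity of |Ω(M)|.

open import Defs
open import Data.Nat using (ℕ; zero; suc; _+_)
open import Data.Nat.Properties using (+-comm; +-suc; suc-injective; +-0-commutativeMonoid)
open import Data.Nat.Divisibility using (_∣_; _∣?_; _∣0; ∣-refl; ∣m∣n⇒∣m+n; ∣m+n∣m⇒∣n)
open import Data.Fin using (Fin)
import Data.Fin as F
open import Data.Fin.Properties using (_≟_)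
open import Data.Bool using (Bool; true; false; not; _∧_; if_then_else_)
open import Data.Bool.Properties using (∧-comm; ∧-identityʳ; ∧-conicalˡ; ∧-conicalʳ)
open import Data.Product using (_×_; _,_; ∃; proj₁; proj₂)
open import Data.Sum using (_⊎_; inj₁; inj₂)
open import Data.Empty using (⊥-elim)
open import Function using (_∘_; _⇔_; mk⇔; Equivalence)
open import Relation.Nullary using (¬_; yes; no; does)
open import Relation.Nullary.Decidable using (dec-true; dec-false)
open import Relation.Binary.PropositionalEquality
open import Algebra.Properties.CommutativeMonoid.Sum +-0-commutativeMonoid
  using (sum; sum-cong-≗; ∑-distrib-+)

𝟙 : Bool → ℕ
𝟙 b = if b then 1 else 0

sumFin≡sum : ∀ d (f : Fin d → ℕ) → sumFin d f ≡ sum f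
sumFin≡sum zero    f = refl
sumFin≡sum (suc d) f = cong (f F.zero +_) (sumFin≡sum d (f ∘ F.suc))

countFin-cong : ∀ {d} {p q : Fin d → Bool} → (∀ i → p i ≡ q i) →
                countFin d p ≡ countFin d q
countFin-cong {zero}  p≗q = refl
countFin-cong {suc d} p≗q = cong₂ _+_ (cong 𝟙 (p≗q F.zero)) (countFin-cong (p≗q ∘ F.suc))

countFin-∧-split : ∀ {d} (p q : Fin d → Bool) →
                   countFin d p ≡ countFin d (λ i → p i ∧ q i) + countFin d (λ i → p i ∧ not (q i))
countFin-∧-split {d} p q = begin
  countFin d p                            ≡⟨ sumFin≡sum d _ ⟩
  sum (λ i → 𝟙 (p i))                     ≡⟨ sum-cong-≗ (λ i → 𝟙-split (p i) (q i)) ⟩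
  sum (λ i → 𝟙 (p∧q i) + 𝟙 (p∧¬q i))      ≡⟨ ∑-distrib-+ (𝟙 ∘ p∧q) (𝟙 ∘ p∧¬q) ⟩
  sum (𝟙 ∘ p∧q) + sum (𝟙 ∘ p∧¬q)          ≡⟨ sym (cong₂ _+_ (sumFin≡sum d _) (sumFin≡sum d _)) ⟩
  countFin d p∧q + countFin d p∧¬q        ∎
  where
  open ≡-Reasoning
  p∧q p∧¬q : Fin d → Bool
  p∧q  i = p i ∧ q i
  p∧¬q i = p i ∧ not (q i)
  𝟙-split : ∀ a b → 𝟙 a ≡ 𝟙 (a ∧ b) + 𝟙 (a ∧ not b)
  𝟙-split true  true  = refl
  𝟙-split true  false = refl
  𝟙-split false _     = refl

countFin≡suc⇒∃ : ∀ {d n} (p : Fin d → Bool) → countFin d p ≡ suc n → ∃ λ x → p x ≡ true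
countFin≡suc⇒∃ {zero} _ ()
countFin≡suc⇒∃ {suc d} p count≡ with p F.zero in p₀
... | true  = F.zero , p₀
... | false with countFin≡suc⇒∃ (p ∘ F.suc) count≡
...   | x , px = F.suc x , px

without : ∀ {d} → Fin d → (Fin d → Bool) → Fin d → Bool
without x p y = p y ∧ not (does (y ≟ x))

without-intro : ∀ {d} {x y : Fin d} (p : Fin d → Bool) → p y ≡ true → y ≢ x → without x p y ≡ true
without-intro {x = x} {y} _ py y≢x = cong₂ _∧_ py (cong not (dec-false (y ≟ x) y≢x))

without-elim : ∀ {d} {x y : Fin d} (p : Fin d → Bool) → without x p y ≡ true → p y ≡ true × y ≢ x
without-elim {x = x} {y} p h = ∧-conicalˡ _ _ h , y≢x
  where
  y≢x : y ≢ x
  y≢x y≡x with () ← subst (λ b → not b ≡ true) (dec-true (y ≟ x) y≡x) (∧-conicalʳ _ _ h)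

countFin-without : ∀ {d} (p : Fin d → Bool) {x : Fin d} → p x ≡ true →
                   countFin d p ≡ suc (countFin d (without x p))
countFin-without {suc d} p {F.zero} px rewrite px =
  cong suc (countFin-cong (λ i → sym (∧-identityʳ (p (F.suc i)))))
countFin-without {suc d} p {F.suc x} px = begin
  𝟙 p₀ + countFin d (p ∘ F.suc)             ≡⟨ cong (𝟙 p₀ +_) (countFin-without (p ∘ F.suc) px) ⟩
  𝟙 p₀ + suc rest                           ≡⟨ +-suc (𝟙 p₀) rest ⟩
  suc (𝟙 p₀ + rest)                         ≡⟨ cong (λ b → suc (𝟙 b + rest)) (sym (∧-identityʳ p₀)) ⟩
  suc (𝟙 (p₀ ∧ true) + rest)                ∎
  where
  open ≡-Reasoning
  p₀ : Bool
  p₀ = p F.zero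
  rest : ℕ
  rest = countFin d (without x (p ∘ F.suc))

record PairingOn {d} (p : Fin d → Bool) (β : Fin d → Fin d) : Set where
  field
    closed        : ∀ {x} → p x ≡ true → p (β x) ≡ true
    involutive    : ∀ {x} → p x ≡ true → β (β x) ≡ x
    fixpoint-free : ∀ {x} → p x ≡ true → β x ≢ x

module _ {d} {p : Fin d → Bool} {β : Fin d → Fin d} (P : PairingOn p β) {x : Fin d} (px : p x ≡ true) where
  open PairingOn P

  without-pair : Fin d → Bool
  without-pair = without (β x) (without x p)

  countFin-without-pair : countFin d p ≡ 2 + countFin d without-pair
  countFin-without-pair =
    trans (countFin-without p px)
          (cong suc (countFin-without (without x p) (without-intro p (closed px) (fixpoint-free px))))

  without-pair-pairing : PairingOn without-pair β
  without-pair-pairing = record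
    { closed        = λ h → let (py , y≢x , y≢βx) = members h in
        without-intro (without x p)
          (without-intro p (closed py)
            (λ βy≡x → y≢βx (β-injective py (closed px) (trans βy≡x (sym (involutive px))))))
          (λ βy≡βx → y≢x (β-injective py px βy≡βx))
    ; involutive    = involutive ∘ proj₁ ∘ members
    ; fixpoint-free = fixpoint-free ∘ proj₁ ∘ members
    }
    where
    members : ∀ {y} → without-pair y ≡ true → p y ≡ true × y ≢ x × y ≢ β x
    members h with without-elim (without x p) h
    ... | h′ , y≢βx with without-elim p h′
    ...   | py , y≢x = py , y≢x , y≢βx
    β-injective : ∀ {y z} → p y ≡ true → p z ≡ true → β y ≡ β z → y ≡ z
    β-injective py pz βy≡βz = trans (sym (involutive py)) (trans (cong β βy≡βz) (involutive pz))

pairing⇒countFin-even : ∀ {d} {p : Fin d → Bool} {β : Fin d → Fin d} →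
                          PairingOn p β → 2 ∣ countFin d p
pairing⇒countFin-even P = go _ P refl
  where
  go : ∀ {d} n {p : Fin d → Bool} {β} → PairingOn p β → countFin d p ≡ n → 2 ∣ n
  go zero    _ _ = 2 ∣0
  go (suc zero) {p} P count≡ with x , px ← countFin≡suc⇒∃ p count≡
    with () ← suc-injective (trans (sym count≡) (countFin-without-pair P px))
  go (suc (suc m)) {p} P count≡ with x , px ← countFin≡suc⇒∃ p count≡ =
    ∣m∣n⇒∣m+n ∣-refl (go m (without-pair-pairing P px)
                           (sym (suc-injective (suc-injective (trans (sym count≡) (countFin-without-pair P px))))))

module _ {d} (M : BorderedMap d) where
  open BorderedMap M

  module _ (outer-φ : ∀ x → outer (φ x) ≡ outer x)
    (inner-triangle : ∀ x → outer x ≡ false → (iter φ 3 x ≡ x) × (φ x ≢ x))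
    (t : Fin d → Bool) (t-α : ∀ x → t (α x) ≡ t x)
    (marked-once : ∀ x → outer x ≡ false → 𝟙 (t x) + 𝟙 (t (φ x)) + 𝟙 (t (φ (φ x))) ≡ 1)
    where

    unmarked-inner : Fin d → Bool
    unmarked-inner x = not (t x) ∧ not (outer x)

    -- In an inner triangle with x unmarked, exactly one of φ x, φ² x is unmarked.
    partner : Fin d → Fin d
    partner x = if t (φ x) then φ (φ x) else φ x

    private
      nor-intro : ∀ {a b} → a ≡ false → b ≡ false → not a ∧ not b ≡ true
      nor-intro refl refl = refl

      nor-elim : ∀ {a b} → not a ∧ not b ≡ true → a ≡ false × b ≡ false
      nor-elim {false} {false} _ = refl , refl
      nor-elim {false} {true}  ()
      nor-elim {true}          ()

      last-of-three : ∀ {b c} → 𝟙 false + 𝟙 b + 𝟙 c ≡ 1 → c ≡ not b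
      last-of-three {true}  {false} _ = refl
      last-of-three {false} {true}  _ = refl
      last-of-three {true}  {true}  ()
      last-of-three {false} {false} ()

      module Triangle {x} (h : unmarked-inner x ≡ true) where
        tx : t x ≡ false
        tx = proj₁ (nor-elim h)

        ox : outer x ≡ false
        ox = proj₂ (nor-elim h)

        φ³≡id : φ (φ (φ x)) ≡ x
        φ³≡id = proj₁ (inner-triangle x ox)

        φ≢id : φ x ≢ x
        φ≢id = proj₂ (inner-triangle x ox)

        φ²≢id : φ (φ x) ≢ x
        φ²≢id φ²≡id = φ≢id (trans (sym (cong φ φ²≡id)) φ³≡id)

        outer-φ¹ : outer (φ x) ≡ false
        outer-φ¹ = trans (outer-φ x) ox

        outer-φ² : outer (φ (φ x)) ≡ false
        outer-φ² = trans (outer-φ (φ x)) outer-φ¹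

        t-φ² : t (φ (φ x)) ≡ not (t (φ x))
        t-φ² = last-of-three (subst (λ a → 𝟙 a + 𝟙 (t (φ x)) + 𝟙 (t (φ (φ x))) ≡ 1) tx (marked-once x ox))

        partner-unmarked : unmarked-inner (partner x) ≡ true
        partner-unmarked with t (φ x) in tφ
        ... | true  = nor-intro (trans t-φ² (cong not tφ)) outer-φ²
        ... | false = nor-intro tφ outer-φ¹

        partner-involutive : partner (partner x) ≡ x
        partner-involutive with t (φ x) in tφ
        ... | true  rewrite φ³≡id | tx = refl
        ... | false rewrite t-φ² | tφ = φ³≡id

        partner-fixpoint-free : partner x ≢ x
        partner-fixpoint-free with t (φ x)
        ... | true  = φ²≢id
        ... | false = φ≢id

    partner-pairing : PairingOn unmarked-inner partner
    partner-pairing = record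
      { closed        = Triangle.partner-unmarked
      ; involutive    = Triangle.partner-involutive
      ; fixpoint-free = Triangle.partner-fixpoint-free
      }

    α-pairing : PairingOn (not ∘ t) α
    α-pairing = record
      { closed        = λ {x} h → trans (cong not (t-α x)) h
      ; involutive    = λ {x} _ → α-invol x
      ; fixpoint-free = λ {x} _ → α-nofix x
      }

    unmarked-outer-even : 2 ∣ countFin d (λ x → outer x ∧ not (t x))
    unmarked-outer-even =
      subst (2 ∣_) (countFin-cong (λ x → ∧-comm (not (t x)) (outer x)))
        (∣m+n∣m⇒∣n (subst (2 ∣_) unmarked-split (pairing⇒countFin-even α-pairing))
                   (pairing⇒countFin-even partner-pairing))
      where
      unmarked-split : countFin d (not ∘ t) ≡
                       countFin d unmarked-inner + countFin d (λ x → not (t x) ∧ outer x)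
      unmarked-split = trans (countFin-∧-split (not ∘ t) outer) (+-comm (countFin d (λ x → not (t x) ∧ outer x)) _)

∣m⇔∣m+n : ∀ {k m n} → k ∣ n → k ∣ m ⇔ k ∣ m + n
∣m⇔∣m+n {k} {m} {n} k∣n =
  mk⇔ (λ k∣m → ∣m∣n⇒∣m+n k∣m k∣n)
      (λ k∣m+n → ∣m+n∣m⇒∣n (subst (k ∣_) (+-comm m n) k∣m+n) k∣n)

isRed≡𝟙 : ∀ κ → isRed κ ≡ 𝟙 (κ ==₂ red)
isRed≡𝟙 red   = refl
isRed≡𝟙 black = refl

black≡not-red : ∀ κ → (κ ==₂ black) ≡ not (κ ==₂ red)
black≡not-red red   = refl
black≡not-red black = refl

rainbow-meets-each-colour : ∀ {a b c} → a ≢ b → b ≢ c → a ≢ c →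
                            ∀ κ → 𝟙 (a ==₃ κ) + 𝟙 (b ==₃ κ) + 𝟙 (c ==₃ κ) ≡ 1
rainbow-meets-each-colour {red}   {red}           a≢b _   _   = ⊥-elim (a≢b refl)
rainbow-meets-each-colour {green} {green}         a≢b _   _   = ⊥-elim (a≢b refl)
rainbow-meets-each-colour {blue}  {blue}          a≢b _   _   = ⊥-elim (a≢b refl)
rainbow-meets-each-colour {b = red}   {red}       _   b≢c _   = ⊥-elim (b≢c refl)
rainbow-meets-each-colour {b = green} {green}     _   b≢c _   = ⊥-elim (b≢c refl)
rainbow-meets-each-colour {b = blue}  {blue}      _   b≢c _   = ⊥-elim (b≢c refl)
rainbow-meets-each-colour {red}   {c = red}       _   _   a≢c = ⊥-elim (a≢c refl)
rainbow-meets-each-colour {green} {c = green}     _   _   a≢c = ⊥-elim (a≢c refl)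
rainbow-meets-each-colour {blue}  {c = blue}      _   _   a≢c = ⊥-elim (a≢c refl)
rainbow-meets-each-colour {red}   {green} {blue}  _   _   _   = λ { red → refl ; green → refl ; blue → refl }
rainbow-meets-each-colour {red}   {blue}  {green} _   _   _   = λ { red → refl ; green → refl ; blue → refl }
rainbow-meets-each-colour {green} {red}   {blue}  _   _   _   = λ { red → refl ; green → refl ; blue → refl }
rainbow-meets-each-colour {green} {blue}  {red}   _   _   _   = λ { red → refl ; green → refl ; blue → refl }
rainbow-meets-each-colour {blue}  {red}   {green} _   _   _   = λ { red → refl ; green → refl ; blue → refl }
rainbow-meets-each-colour {blue}  {green} {red}   _   _   _   = λ { red → refl ; green → refl ; blue → refl }

module _ {d} {M : BorderedMap d} (H : IsSemiMPGShared M) where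
  open BorderedMap M
  open IsSemiMPGShared H

  black-along-Ω-even : (c : Fin d → Col2) → IsRTiling M c → 2 ∣ Ωcount₂ M c black
  black-along-Ω-even c (c-α , one-red) =
    subst (2 ∣_) (countFin-cong (λ x → cong (outer x ∧_) (sym (black≡not-red (c x)))))
      (unmarked-outer-even M outer-face inner-tri (λ x → c x ==₂ red) (cong (_==₂ red) ∘ c-α) red-once)
    where
    red-once : ∀ x → outer x ≡ false →
               𝟙 (c x ==₂ red) + 𝟙 (c (φ x) ==₂ red) + 𝟙 (c (φ (φ x)) ==₂ red) ≡ 1
    red-once x ox rewrite sym (isRed≡𝟙 (c x)) | sym (isRed≡𝟙 (c (φ x))) | sym (isRed≡𝟙 (c (φ (φ x)))) =
      one-red x ox

  colour-along-Ω-parity : (c : Fin d → Col3) → IsRGBTiling M c →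
                          ∀ κ → 2 ∣ Ωcount₃ M c κ ⇔ 2 ∣ |Ω| M
  colour-along-Ω-parity c (c-α , rainbow) κ rewrite countFin-∧-split outer (λ x → c x ==₃ κ) =
    ∣m⇔∣m+n (unmarked-outer-even M outer-face inner-tri (λ x → c x ==₃ κ) (cong (_==₃ κ) ∘ c-α)
              (λ x ox → let (a≢b , b≢c , a≢c) = rainbow x ox in rainbow-meets-each-colour a≢b b≢c a≢c κ))

parities-agree : ∀ {A : Set} {n} (f : A → ℕ) → (∀ a → 2 ∣ f a ⇔ 2 ∣ n) →
  ((∀ a → 2 ∣ f a) ⊎ (∀ a → ¬ 2 ∣ f a)) ×
  (2 ∣ n → ∀ a → 2 ∣ f a) ×
  (¬ 2 ∣ n → ∀ a → ¬ 2 ∣ f a)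
parities-agree {n = n} f f≡n = all-same , all-even , all-odd
  where
  all-even : 2 ∣ n → ∀ a → 2 ∣ f a
  all-even 2∣n a = Equivalence.from (f≡n a) 2∣n
  all-odd : ¬ 2 ∣ n → ∀ a → ¬ 2 ∣ f a
  all-odd 2∤n a 2∣fa = 2∤n (Equivalence.to (f≡n a) 2∣fa)
  all-same : (∀ a → 2 ∣ f a) ⊎ (∀ a → ¬ 2 ∣ f a)
  all-same with 2 ∣? n
  ... | yes 2∣n = inj₁ (all-even 2∣n)
  ... | no  2∤n = inj₂ (all-odd 2∤n)

lemma6p2 :
    -- (a)
    (∀ (d : ℕ) (M : BorderedMap d) → IsSemiMPG M →
       (c : Fin d → Col2) → IsRTiling M c → 2 ∣ Ωcount₂ M c black) ×
    -- (a')
    (∀ (d : ℕ) (M : BorderedMap d) → IsSemiMPGShared M →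
       (c : Fin d → Col2) → IsRTiling M c → 2 ∣ Ωcount₂ M c black) ×
    -- (b)
    (∀ (d : ℕ) (M : BorderedMap d) → IsSemiMPG M →
       (c : Fin d → Col3) → IsRGBTiling M c →
         ((∀ κ → 2 ∣ Ωcount₃ M c κ) ⊎ (∀ κ → ¬ 2 ∣ Ωcount₃ M c κ)) ×
         (2 ∣ |Ω| M → ∀ κ → 2 ∣ Ωcount₃ M c κ) ×
         (¬ 2 ∣ |Ω| M → ∀ κ → ¬ 2 ∣ Ωcount₃ M c κ))
lemma6p2 =
  (λ _ _ (H , _) → black-along-Ω-even H) ,
  (λ _ _ H → black-along-Ω-even H) ,
  (λ _ M (H , _) c rgb → parities-agree (Ωcount₃ M c) (colour-along-Ω-parity H c rgb))
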